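{- Fix $\epsilon>0$ and an integer-valued function $k=k(n)\ge 2$ with $k=O(n^{1/4-\epsilon})$. Let $V$ be a $k$-element subset of $\{0,1,\dots,n-1\}$ chosen uniformly at random, and let $U$, $W$, $W_1$, $U_1$ be as in the context. Then for every $\delta>0$ there is $n(\epsilon,\delta)$ such that for all $n>n(\epsilon,\delta)$, $U_1=W\cap W_1$ with probability greater than $1-\delta$.
   Context: Write $V=\{v_0<v_1<\dots<v_{k-1}\}$. Define $U=V-v_0$ if $v_1-v_0\le v_{k-1}-v_{k-2}$, and $U=v_{k-1}-V=\{v_{k-1}-v:v\in V\}$ otherwise. Write $U=\{u_0<\dots<u_{k-1}\}$ (so $u_0=0$), $u_{ij}=u_j-u_i$, $W=\{u_{ij}:0\le i\le j\le k-1\}$ (the pairwise distance set of $V$), $W_1=W+u_{01}=\{w+u_{01}:w\in W\}$, and $U_1=\{u_{0j}:1\le j\le k-1\}=U\setminus\{0\}$. -}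

module Defs where

open import Data.Nat using (ℕ; zero; suc; _+_; _*_; _∸_; _^_; _≤_; _<_; _≤ᵇ_)
open import Data.Bool using (if_then_else_)
open import Data.List using (List; []; _∷_; _++_; [_]; map; length)
open import Data.List.Membership.Propositional using (_∈_)
open import Data.Product using (Σ; _×_; ∃-syntax)
open import Relation.Binary.PropositionalEquality using (_≡_; _≢_)
open import Function.Bundles using (_⇔_)

-- combs n k : all k-element subsets of {0,…,n-1}, each listed exactly once
-- as a strictly increasing list v₀ < v₁ < … < v_{k-1}.
combs : ℕ → ℕ → List (List ℕ)
combs zero    zero    = [] ∷ []
combs zero    (suc k) = []
combs (suc n) zero    = [] ∷ []
combs (suc n) (suc k) = combs n (suc k) ++ map (λ l → l ++ [ n ]) (combs n k)

-- v₀, v₁, v_{k-1}, v_{k-2} of an increasing list (default 0; only used for k ≥ 2)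
first : List ℕ → ℕ
first []      = 0
first (x ∷ _) = x

second : List ℕ → ℕ
second (_ ∷ y ∷ _) = y
second _           = 0

lastL : List ℕ → ℕ
lastL []            = 0
lastL (x ∷ [])      = x
lastL (_ ∷ y ∷ l)   = lastL (y ∷ l)

penult : List ℕ → ℕ
penult (x ∷ _ ∷ [])     = x
penult (_ ∷ y ∷ z ∷ l)  = penult (y ∷ z ∷ l)
penult _                = 0

leftCase : List ℕ → _
leftCase V = (second V ∸ first V) ≤ᵇ (lastL V ∸ penult V)

U : List ℕ → List ℕ
U V = if leftCase V then map (λ v → v ∸ first V) V else map (λ v → lastL V ∸ v) V

-- u₀₁ = u₁ - u₀ = second smallest element of U
u01 : List ℕ → ℕ
u01 V = if leftCase V then second V ∸ first V else lastL V ∸ penult V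

InU1 : List ℕ → ℕ → Set
InU1 V x = (x ∈ U V) × (x ≢ 0)

InW : List ℕ → ℕ → Set
InW V x = ∃[ a ] ∃[ b ] (a ∈ U V × b ∈ U V × a ≤ b × x ≡ b ∸ a)

InW1 : List ℕ → ℕ → Set
InW1 V x = ∃[ w ] (InW V w × x ≡ w + u01 V)

Good : List ℕ → Set
Good V = (x : ℕ) → InU1 V x ⇔ (InW V x × InW1 V x)

-- Call V bad if it contains y, Y, Z, W with y ∉ {P, Q, Z, W} and y + Y + P = Z + W + Q, where
-- (P, Q) is (v₀, v₁) or (v_{k-1}, v_{k-2}). If V is not bad then U₁ = W ∩ W₁: an element
-- b - a = (d - c) + u₀₁ of W ∩ W₁ with a ≠ 0 and b - a ≠ u₀₁ gives the relation b + c = a + d + u₀₁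
-- in U, in which b or c is a term distinct from 0, u₀₁, a, d, and undoing the translation or
-- reflection from V to U turns it into a bad quadruple. A bad V is determined by V ∖ {y}, the
-- choice of (P, Q) and the positions of Y, Z, W in V ∖ {y}, since y can then be solved for; so at
-- most 2k³ C(n,k-1) of the C(n,k) sets are bad, a fraction of order k⁴/n, which tends to 0 because
-- k = O(n^{1/4-ε}).

module Submission where

open import Defs
open import Data.Nat using (ℕ; zero; suc; _+_; _*_; _∸_; _^_; _≤_; _<_; z≤n; s≤s; _≟_; _≤?_; _<?_; _/_; NonZero; >-nonZero)
open import Data.Nat.Properties
open import Algebra.Properties.CommutativeSemigroup *-commutativeSemigroup using (x∙yz≈y∙xz)
open import Data.Nat.DivMod using (m*n/n≡m)
open import Data.Nat.Tactic.RingSolver using (solve-∀)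
open import Data.Bool using (Bool; true; false; if_then_else_)
open import Data.Fin using (Fin)
import Data.Fin.Properties as Fin
open import Data.List using (List; []; _∷_; _++_; [_]; map; length; lookup; upTo; filter; cartesianProduct)
open import Data.List.Properties using (length-++; length-map; length-upTo; ∷ʳ-injectiveˡ)
open import Data.List.Relation.Unary.All as All using (All; []; _∷_)
import Data.List.Relation.Unary.All.Properties as AllP
open import Data.List.Relation.Unary.AllPairs as AllPairs using (AllPairs; []; _∷_)
import Data.List.Relation.Unary.AllPairs.Properties as AllPairsP
open import Data.List.Relation.Unary.Any using (Any; here; there; index; any?)
open import Data.List.Relation.Unary.Any.Properties using (lookup-index)
open import Data.List.Relation.Unary.Unique.Propositional using (Unique)
import Data.List.Relation.Unary.Unique.Propositional.Properties as UniqueP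
open import Data.List.Relation.Binary.Sublist.Propositional using (_⊆_)
open import Data.List.Relation.Binary.Sublist.Propositional.Properties using (filter-⊆)
open import Data.List.Membership.Propositional using (_∈_; find; lose)
open import Data.List.Membership.Propositional.Properties
open import Data.Product using (_×_; _,_; ∃-syntax; proj₁; proj₂)
open import Data.Sum using (_⊎_; inj₁; inj₂)
open import Data.Empty using (⊥-elim)
open import Relation.Nullary using (¬_; Dec; yes; no)
open import Relation.Nullary.Decidable using (_×-dec_; _⊎-dec_; ¬?; map′)
open import Relation.Binary.PropositionalEquality hiding ([_])
open import Function.Base using (_∘_)
open import Function.Bundles using (mk⇔)

-- k-subsets of {0, …, n-1}

Sorted : List ℕ → Set
Sorted = AllPairs _<_

binom : ℕ → ℕ → ℕ
binom n k = length (combs n k)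

binom-suc : ∀ n k → binom (suc n) (suc k) ≡ binom n (suc k) + binom n k
binom-suc n k = trans (length-++ (combs n (suc k))) (cong (binom n (suc k) +_) (length-map _ (combs n k)))

binom-zero : ∀ n → binom n 0 ≡ 1
binom-zero zero    = refl
binom-zero (suc n) = refl

sorted-∷ʳ : ∀ {l m} → Sorted l → All (_< m) l → Sorted (l ++ [ m ])
sorted-∷ʳ sl l<m = AllPairsP.++⁺ sl ([] ∷ []) (All.map (λ x<m → x<m ∷ []) l<m)

∈-combs⁻ : ∀ n k {V} → V ∈ combs n k → Sorted V × All (_< n) V × length V ≡ k
∈-combs⁻ zero    zero    (here refl) = [] , [] , refl
∈-combs⁻ (suc n) zero    (here refl) = [] , [] , refl
∈-combs⁻ (suc n) (suc k) V∈ with ∈-++⁻ (combs n (suc k)) V∈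
... | inj₁ V∈′ =
  let sV , V<n , lV = ∈-combs⁻ n (suc k) V∈′ in sV , All.map m<n⇒m<1+n V<n , lV
... | inj₂ V∈′ with ∈-map⁻ (_++ [ n ]) V∈′
... | l , l∈ , refl =
  let sl , l<n , ll = ∈-combs⁻ n k l∈ in
  sorted-∷ʳ sl l<n , AllP.++⁺ (All.map m<n⇒m<1+n l<n) (≤-refl ∷ []) ,
  trans (length-++ l) (trans (+-comm (length l) 1) (cong suc ll))

sorted-split : ∀ n {V} → Sorted V → All (_< suc n) V →
               All (_< n) V ⊎ ∃[ l ] (V ≡ l ++ [ n ] × Sorted l × All (_< n) l)
sorted-split n [] [] = inj₁ []
sorted-split n {x ∷ r} (x<r ∷ sr) (x≤n ∷ r≤n) with sorted-split n sr r≤n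
... | inj₂ (l , refl , sl , l<n) =
  inj₂ (x ∷ l , refl , AllP.++⁻ˡ l x<r ∷ sl , All.lookup x<r (∈-++⁺ʳ l (here refl)) ∷ l<n)
... | inj₁ r<n with x <? n
...   | yes x<n = inj₁ (x<n ∷ r<n)
...   | no x≮n with r | x<r | r<n
...     | []    | _       | _       = inj₂ ([] , cong [_] (≤-antisym (≤-pred x≤n) (≮⇒≥ x≮n)) , [] , [])
...     | y ∷ _ | x<y ∷ _ | y<n ∷ _ = ⊥-elim (x≮n (<-trans x<y y<n))

∈-combs⁺ : ∀ n k {V} → Sorted V → All (_< n) V → length V ≡ k → V ∈ combs n k
∈-combs⁺ zero    zero    {[]}    _  _          _  = here refl
∈-combs⁺ zero    (suc k) {[]}    _  _          ()
∈-combs⁺ zero    k       {_ ∷ _} _  (() ∷ _)   _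
∈-combs⁺ (suc n) zero    {[]}    _  _          _  = here refl
∈-combs⁺ (suc n) (suc k)         sV V<n        lV with sorted-split n sV V<n
... | inj₁ V<n′ = ∈-++⁺ˡ (∈-combs⁺ n (suc k) sV V<n′ lV)
... | inj₂ (l , refl , sl , l<n) =
  ∈-++⁺ʳ (combs n (suc k)) (∈-map⁺ (_++ [ n ])
    (∈-combs⁺ n k sl l<n (suc-injective (trans (+-comm 1 (length l)) (trans (sym (length-++ l)) lV)))))

combs-unique : ∀ n k → Unique (combs n k)
combs-unique zero    zero    = [] ∷ []
combs-unique zero    (suc k) = []
combs-unique (suc n) zero    = [] ∷ []
combs-unique (suc n) (suc k) =
  UniqueP.++⁺ (combs-unique n (suc k)) (UniqueP.map⁺ (∷ʳ-injectiveˡ _ _) (combs-unique n k)) disjoint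
  where
  disjoint : ∀ {V} → ¬ (V ∈ combs n (suc k) × V ∈ map (_++ [ n ]) (combs n k))
  disjoint (V∈ , V∈′) with ∈-map⁻ (_++ [ n ]) V∈′
  ... | l , _ , refl = <-irrefl refl (All.lookup (proj₁ (proj₂ (∈-combs⁻ n (suc k) V∈))) (∈-++⁺ʳ l (here refl)))

binom-pos : ∀ {n k} → k ≤ n → 0 < binom n k
binom-pos {zero}  {zero}  _         = s≤s z≤n
binom-pos {suc n} {zero}  _         = s≤s z≤n
binom-pos {suc n} {suc k} (s≤s k≤n) =
  <-≤-trans (binom-pos k≤n) (≤-trans (m≤n+m (binom n k) (binom n (suc k))) (≤-reflexive (sym (binom-suc n k))))

-- The counting form of (n - k) C(n,k) = (k+1) C(n,k+1), valid without k ≤ n.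
binom-absorption : ∀ n k → suc k * binom n (suc k) + k * binom n k ≡ n * binom n k
binom-absorption zero    zero    = refl
binom-absorption zero    (suc k) = cong₂ _+_ (*-zeroʳ (suc (suc k))) (*-zeroʳ (suc k))
binom-absorption (suc n) zero    = begin
  1 * binom (suc n) 1 + 0       ≡⟨ trans (+-identityʳ _) (*-identityˡ _) ⟩
  binom (suc n) 1               ≡⟨ binom-suc n 0 ⟩
  binom n 1 + binom n 0         ≡⟨ cong₂ _+_ binom-one (binom-zero n) ⟩
  n + 1                         ≡⟨ +-comm n 1 ⟩
  suc n                         ≡˘⟨ *-identityʳ (suc n) ⟩
  suc n * 1                     ≡˘⟨ cong (suc n *_) (binom-zero (suc n)) ⟩
  suc n * binom (suc n) 0       ∎
  where
  open ≡-Reasoning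
  binom-one : binom n 1 ≡ n
  binom-one = begin
    binom n 1                   ≡˘⟨ trans (+-identityʳ _) (*-identityˡ _) ⟩
    1 * binom n 1 + 0 * binom n 0 ≡⟨ binom-absorption n 0 ⟩
    n * binom n 0               ≡⟨ trans (cong (n *_) (binom-zero n)) (*-identityʳ n) ⟩
    n                           ∎
binom-absorption (suc n) (suc j) = begin
  suc (suc j) * binom (suc n) (suc (suc j)) + suc j * binom (suc n) (suc j)
    ≡⟨ cong₂ (λ x y → suc (suc j) * x + suc j * y) (binom-suc n (suc j)) (binom-suc n j) ⟩
  suc (suc j) * (A + B) + suc j * (B + C)
    ≡⟨ regroup j A B C ⟩
  (suc (suc j) * A + suc j * B) + B + (suc j * B + j * C) + C
    ≡⟨ cong₂ (λ x y → x + B + y + C) (binom-absorption n (suc j)) (binom-absorption n j) ⟩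
  n * B + B + n * C + C
    ≡⟨ collect n B C ⟩
  suc n * (B + C)
    ≡˘⟨ cong (suc n *_) (binom-suc n j) ⟩
  suc n * binom (suc n) (suc j) ∎
  where
  open ≡-Reasoning
  A B C : ℕ
  A = binom n (suc (suc j))
  B = binom n (suc j)
  C = binom n j
  regroup : ∀ j A B C → suc (suc j) * (A + B) + suc j * (B + C) ≡
                        (suc (suc j) * A + suc j * B) + B + (suc j * B + j * C) + C
  regroup = solve-∀
  collect : ∀ n B C → n * B + B + n * C + C ≡ suc n * (B + C)
  collect = solve-∀

-- Counting by decoding

lookup-injective : ∀ {A : Set} {xs : List A} → Unique xs → ∀ i j → lookup xs i ≡ lookup xs j → i ≡ j
lookup-injective (_    ∷ _) Fin.zero    Fin.zero    _ = refl
lookup-injective (x∉xs ∷ _) Fin.zero    (Fin.suc j) e = ⊥-elim (All.lookup x∉xs (∈-lookup j) e)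
lookup-injective (x∉xs ∷ _) (Fin.suc i) Fin.zero    e = ⊥-elim (All.lookup x∉xs (∈-lookup i) (sym e))
lookup-injective (_ ∷ u)    (Fin.suc i) (Fin.suc j) e = cong Fin.suc (lookup-injective u i j e)

-- If |L| > |M|, pigeonhole gives two positions of L with the same code, hence equal entries.
length-≤-by-decoding : ∀ {A B : Set} (L : List A) (M : List B) → Unique L → (decode : B → A) →
                       (∀ {x} → x ∈ L → ∃[ c ] (c ∈ M × decode c ≡ x)) → length L ≤ length M
length-≤-by-decoding L M uL decode encode = ≮⇒≥ λ M<L →
  let i , j , i<j , same-code = Fin.pigeonhole M<L code in
  Fin.<⇒≢ i<j (lookup-injective uL i j (trans (sym (decodes i)) (trans (cong (decode ∘ lookup M) same-code) (decodes j))))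
  where
  code : Fin (length L) → Fin (length M)
  code i = index (proj₁ (proj₂ (encode (∈-lookup i))))
  decodes : ∀ i → decode (lookup M (code i)) ≡ lookup L i
  decodes i = let _ , c∈ , c↦ = encode (∈-lookup i) in trans (cong decode (sym (lookup-index c∈))) c↦

delete : ℕ → List ℕ → List ℕ
delete y []      = []
delete y (x ∷ l) with y ≟ x
... | yes _ = l
... | no  _ = x ∷ delete y l

length-delete : ∀ {y} l → y ∈ l → suc (length (delete y l)) ≡ length l
length-delete {y} (x ∷ l) y∈ with y ≟ x
length-delete     (x ∷ l) _          | yes _   = refl
length-delete     (x ∷ l) (here y≡x) | no y≢x  = ⊥-elim (y≢x y≡x)
length-delete     (x ∷ l) (there y∈) | no _    = cong suc (length-delete l y∈)

All-delete : ∀ {P : ℕ → Set} {y} l → All P l → All P (delete y l)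
All-delete         []      []         = []
All-delete {y = y} (x ∷ l) (px ∷ pl) with y ≟ x
... | yes _ = pl
... | no  _ = px ∷ All-delete l pl

sorted-delete : ∀ {y} l → Sorted l → Sorted (delete y l)
sorted-delete     []      []          = []
sorted-delete {y} (x ∷ l) (x<l ∷ sl) with y ≟ x
... | yes _ = sl
... | no  _ = All-delete l x<l ∷ sorted-delete l sl

∈-delete : ∀ {y z} l → z ∈ l → z ≢ y → z ∈ delete y l
∈-delete {y} (x ∷ l) z∈ z≢y with y ≟ x
∈-delete     (x ∷ l) (here refl) z≢y | yes refl = ⊥-elim (z≢y refl)
∈-delete     (x ∷ l) (there z∈)  _   | yes _    = z∈
∈-delete     (x ∷ l) (here z≡x)  _   | no  _    = here z≡x
∈-delete     (x ∷ l) (there z∈)  z≢y | no  _    = there (∈-delete l z∈ z≢y)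

insert : ℕ → List ℕ → List ℕ
insert y []      = [ y ]
insert y (x ∷ l) with y ≤? x
... | yes _ = y ∷ x ∷ l
... | no  _ = x ∷ insert y l

insert-delete : ∀ {y} V → Sorted V → y ∈ V → insert y (delete y V) ≡ V
insert-delete {y} (x ∷ r) (x<r ∷ sr) y∈ with y ≟ x
insert-delete (x ∷ [])    _          _          | yes refl = refl
insert-delete (x ∷ z ∷ r) (x<r ∷ _)  _          | yes refl with x ≤? z
... | yes _   = refl
... | no  x≰z = ⊥-elim (x≰z (<⇒≤ (All.head x<r)))
insert-delete (x ∷ r)     _          (here y≡x) | no y≢x = ⊥-elim (y≢x y≡x)
insert-delete {y} (x ∷ r) (x<r ∷ sr) (there y∈) | no _ with y ≤? x
... | yes y≤x = ⊥-elim (<⇒≱ (All.lookup x<r y∈) y≤x)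
... | no  _   = cong (x ∷_) (insert-delete r sr y∈)

nth : List ℕ → ℕ → ℕ
nth []      _       = 0
nth (x ∷ l) zero    = x
nth (x ∷ l) (suc i) = nth l i

∈⇒nth : ∀ {z} l → z ∈ l → ∃[ i ] (i < length l × nth l i ≡ z)
∈⇒nth (x ∷ l) (here refl) = 0 , s≤s z≤n , refl
∈⇒nth (x ∷ l) (there z∈)  = let i , i< , e = ∈⇒nth l z∈ in suc i , s≤s i< , e

first-second-delete : ∀ {y} V → y ≢ first V → y ≢ second V →
                      first (delete y V) ≡ first V × second (delete y V) ≡ second V
first-second-delete     []          _   _   = refl , refl
first-second-delete {y} (x ∷ [])    y≢x _   with y ≟ x
... | yes y≡x = ⊥-elim (y≢x y≡x)
... | no  _   = refl , refl
first-second-delete {y} (x ∷ z ∷ r) y≢x y≢z with y ≟ x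
... | yes y≡x = ⊥-elim (y≢x y≡x)
... | no  _ with y ≟ z
...   | yes y≡z = ⊥-elim (y≢z y≡z)
...   | no  _   = refl , refl

lastL-∷ : ∀ x D → 1 ≤ length D → lastL (x ∷ D) ≡ lastL D
lastL-∷ x (_ ∷ _) _ = refl

penult-∷ : ∀ x D → 2 ≤ length D → penult (x ∷ D) ≡ penult D
penult-∷ x (_ ∷ _ ∷ _) _         = refl
penult-∷ x (_ ∷ [])    (s≤s ())

lastL-penult-delete : ∀ {y} V → y ∈ V → y ≢ lastL V → y ≢ penult V →
                      lastL (delete y V) ≡ lastL V × penult (delete y V) ≡ penult V
lastL-penult-delete (x ∷ [])     (here y≡x)                 y≢x _   = ⊥-elim (y≢x y≡x)
lastL-penult-delete (x ∷ z ∷ []) (here y≡x)                 _   y≢x = ⊥-elim (y≢x y≡x)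
lastL-penult-delete (x ∷ z ∷ []) (there (here y≡z))         y≢z _   = ⊥-elim (y≢z y≡z)
lastL-penult-delete {y} (x ∷ z ∷ w ∷ r) y∈ y≢L y≢P with y ≟ x
... | yes _ = refl , refl
lastL-penult-delete (x ∷ z ∷ w ∷ r) (here y≡x) _ _ | no y≢x = ⊥-elim (y≢x y≡x)
lastL-penult-delete (x ∷ z ∷ w ∷ []) (there (here y≡z)) _ y≢z | no _ = ⊥-elim (y≢z y≡z)
lastL-penult-delete (x ∷ z ∷ w ∷ []) (there (there (here y≡w))) y≢w _ | no _ = ⊥-elim (y≢w y≡w)
lastL-penult-delete {y} (x ∷ z ∷ w ∷ v ∷ r) (there y∈) y≢L y≢P | no _ =
  trans (lastL-∷ x D (≤-trans (s≤s z≤n) size)) (proj₁ IH) , trans (penult-∷ x D size) (proj₂ IH)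
  where
  D = delete y (z ∷ w ∷ v ∷ r)
  size : 2 ≤ length D
  size = ≤-trans (m≤m+n 2 (length r)) (≤-reflexive (sym (suc-injective (length-delete (z ∷ w ∷ v ∷ r) y∈))))
  IH = lastL-penult-delete (z ∷ w ∷ v ∷ r) y∈ y≢L y≢P

-- Bad sets are rare

outer inner : Bool → List ℕ → ℕ
outer true  = first
outer false = lastL
inner true  = second
inner false = penult

outer-inner-delete : ∀ s {y} V → y ∈ V → y ≢ outer s V → y ≢ inner s V →
                     outer s (delete y V) ≡ outer s V × inner s (delete y V) ≡ inner s V
outer-inner-delete true  V _  = first-second-delete V
outer-inner-delete false V y∈ = lastL-penult-delete V y∈

SumRelation : Bool → List ℕ → ℕ → ℕ → ℕ → ℕ → Set
SumRelation s V y Y Z W =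
  y ≢ outer s V × y ≢ inner s V × y ≢ Z × y ≢ W × y + Y + outer s V ≡ Z + W + inner s V

sumRelation? : ∀ s V y Y Z W → Dec (SumRelation s V y Y Z W)
sumRelation? s V y Y Z W =
  ¬? (y ≟ outer s V) ×-dec ¬? (y ≟ inner s V) ×-dec ¬? (y ≟ Z) ×-dec ¬? (y ≟ W) ×-dec
  (y + Y + outer s V ≟ Z + W + inner s V)

BadOn : Bool → List ℕ → Set
BadOn s V = ∃[ y ] ∃[ Y ] ∃[ Z ] ∃[ W ] (y ∈ V × Y ∈ V × Z ∈ V × W ∈ V × SumRelation s V y Y Z W)

Bad : List ℕ → Set
Bad V = BadOn true V ⊎ BadOn false V

bad? : ∀ V → Dec (Bad V)
bad? V = badOn? true ⊎-dec badOn? false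
  where
  badOn? : ∀ s → Dec (BadOn s V)
  badOn? s = map′ found lost (any? (λ y → any? (λ Y → any? (λ Z → any? (sumRelation? s V y Y Z) V) V) V) V)
    where
    found : Any (λ y → Any (λ Y → Any (λ Z → Any (SumRelation s V y Y Z) V) V) V) V → BadOn s V
    found p =
      let y , y∈ , q = find p
          Y , Y∈ , r = find q
          Z , Z∈ , t = find r
          W , W∈ , rel = find t
      in y , Y , Z , W , y∈ , Y∈ , Z∈ , W∈ , rel
    lost : BadOn s V → Any (λ y → Any (λ Y → Any (λ Z → Any (SumRelation s V y Y Z) V) V) V) V
    lost (y , Y , Z , W , y∈ , Y∈ , Z∈ , W∈ , rel) = lose y∈ (lose Y∈ (lose Z∈ (lose W∈ rel)))

-- A code (V′ , s , j , i , i′) stands for V′ = V ∖ {y}, the side s, and the positions in V′ of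
-- Z (i), W (i′) and Y (j - 1), where j = 0 means Y = y.
Code : Set
Code = List ℕ × Bool × ℕ × ℕ × ℕ

codes : ℕ → ℕ → List Code
codes n k = cartesianProduct (combs n (k ∸ 1))
              (cartesianProduct (true ∷ false ∷ []) (cartesianProduct (upTo k) (cartesianProduct (upTo k) (upTo k))))

length-cartesianProduct : ∀ {A B : Set} (xs : List A) (ys : List B) →
                          length (cartesianProduct xs ys) ≡ length xs * length ys
length-cartesianProduct []       ys = refl
length-cartesianProduct (x ∷ xs) ys =
  trans (length-++ (map (x ,_) ys)) (cong₂ _+_ (length-map _ ys) (length-cartesianProduct xs ys))

length-codes : ∀ n k → length (codes n k) ≡ binom n (k ∸ 1) * (2 * (k * (k * k)))
length-codes n k = begin
  length (codes n k)                            ≡⟨ length-cartesianProduct (combs n (k ∸ 1)) rest ⟩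
  binom n (k ∸ 1) * length rest                 ≡⟨ cong (binom n (k ∸ 1) *_) (length-cartesianProduct bools triples) ⟩
  binom n (k ∸ 1) * (2 * length triples)        ≡⟨ cong (λ x → binom n (k ∸ 1) * (2 * x)) length-triples ⟩
  binom n (k ∸ 1) * (2 * (k * (k * k)))         ∎
  where
  open ≡-Reasoning
  bools : List Bool
  bools = true ∷ false ∷ []
  ks : List ℕ
  ks = upTo k
  pairs : List (ℕ × ℕ)
  pairs = cartesianProduct ks ks
  triples : List (ℕ × ℕ × ℕ)
  triples = cartesianProduct ks pairs
  rest : List (Bool × ℕ × ℕ × ℕ)
  rest = cartesianProduct bools triples
  length-triples : length triples ≡ k * (k * k)
  length-triples = trans (length-cartesianProduct ks pairs)
    (cong₂ _*_ (length-upTo k) (trans (length-cartesianProduct ks ks) (cong₂ _*_ (length-upTo k) (length-upTo k))))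

-- The deleted element y is recovered from y + Y + P = Z + W + Q.
missing : Bool → List ℕ → ℕ → ℕ → ℕ → ℕ
missing s V′ zero    i i′ = (nth V′ i + nth V′ i′ + inner s V′ ∸ outer s V′) / 2
missing s V′ (suc j) i i′ = nth V′ i + nth V′ i′ + inner s V′ ∸ (nth V′ j + outer s V′)

decode : Code → List ℕ
decode (V′ , s , j , i , i′) = insert (missing s V′ j i i′) V′

halve-relation : ∀ y P S → y + y + P ≡ S → (S ∸ P) / 2 ≡ y
halve-relation y P S refl = begin
  (y + y + P ∸ P) / 2  ≡⟨ cong (_/ 2) (m+n∸n≡m (y + y) P) ⟩
  (y + y) / 2          ≡⟨ cong (λ x → (y + x) / 2) (sym (+-identityʳ y)) ⟩
  (2 * y) / 2          ≡⟨ cong (_/ 2) (*-comm 2 y) ⟩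
  (y * 2) / 2          ≡⟨ m*n/n≡m y 2 ⟩
  y                    ∎
  where open ≡-Reasoning

solve-relation : ∀ y Y P S → y + Y + P ≡ S → S ∸ (Y + P) ≡ y
solve-relation y Y P S refl = trans (cong (_∸ (Y + P)) (+-assoc y Y P)) (m+n∸n≡m y (Y + P))

bool∈ : ∀ s → s ∈ true ∷ false ∷ []
bool∈ true  = here refl
bool∈ false = there (here refl)

encode : ∀ {n k V} s → V ∈ combs n k → BadOn s V → ∃[ c ] (c ∈ codes n k × decode c ≡ V)
encode {n} {k} {V} s V∈ (y , Y , Z , W , y∈ , Y∈ , Z∈ , W∈ , y≢P , y≢Q , y≢Z , y≢W , relation)
  with ∈-combs⁻ n k V∈
     | ∈⇒nth (delete y V) (∈-delete V Z∈ (y≢Z ∘ sym))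
     | ∈⇒nth (delete y V) (∈-delete V W∈ (y≢W ∘ sym))
... | sorted , V<n , length-V | i , i< , Z-at | i′ , i′< , W-at =
  (V′ , s , proj₁ Y-position , i , i′) , code∈ , decoded
  where
  V′ : List ℕ
  V′ = delete y V
  length-V′ : suc (length V′) ≡ k
  length-V′ = trans (length-delete V y∈) length-V
  <k : ∀ {x} → x < length V′ → x < k
  <k x< = <-trans x< (≤-reflexive length-V′)
  ends : outer s V′ ≡ outer s V × inner s V′ ≡ inner s V
  ends = outer-inner-delete s V y∈ y≢P y≢Q
  right-side : nth V′ i + nth V′ i′ + inner s V′ ≡ Z + W + inner s V
  right-side = cong₂ _+_ (cong₂ _+_ Z-at W-at) (proj₂ ends)
  Y-position : ∃[ j ] (j < k × missing s V′ j i i′ ≡ y)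
  Y-position with Y ≟ y
  ... | yes refl = 0 , subst (0 <_) length-V′ (s≤s z≤n) ,
                   trans (cong₂ (λ S P → (S ∸ P) / 2) right-side (proj₁ ends))
                         (halve-relation y (outer s V) (Z + W + inner s V) relation)
  ... | no Y≢y with ∈⇒nth V′ (∈-delete V Y∈ Y≢y)
  ...   | j , j< , Y-at = suc j , subst (suc j <_) length-V′ (s≤s j<) ,
                          trans (cong₂ _∸_ right-side (cong₂ _+_ Y-at (proj₁ ends)))
                                (solve-relation y Y (outer s V) (Z + W + inner s V) relation)
  code∈ : (V′ , s , proj₁ Y-position , i , i′) ∈ codes n k
  code∈ = ∈-cartesianProduct⁺
    (∈-combs⁺ n (k ∸ 1) (sorted-delete V sorted) (All-delete V V<n) (cong (_∸ 1) length-V′))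
    (∈-cartesianProduct⁺ (bool∈ s) (∈-cartesianProduct⁺ (∈-upTo⁺ (proj₁ (proj₂ Y-position)))
      (∈-cartesianProduct⁺ (∈-upTo⁺ (<k i<)) (∈-upTo⁺ (<k i′<)))))
  decoded : decode (V′ , s , proj₁ Y-position , i , i′) ≡ V
  decoded = trans (cong (λ x → insert x V′) (proj₂ (proj₂ Y-position))) (insert-delete V sorted y∈)

bad-count : ∀ n k → length (filter bad? (combs n k)) ≤ binom n (k ∸ 1) * (2 * (k * (k * k)))
bad-count n k = ≤-trans (length-≤-by-decoding (filter bad? (combs n k)) (codes n k)
                          (UniqueP.filter⁺ bad? (combs-unique n k)) decode encode-filtered)
                        (≤-reflexive (length-codes n k))
  where
  encode-filtered : ∀ {V} → V ∈ filter bad? (combs n k) → ∃[ c ] (c ∈ codes n k × decode c ≡ V)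
  encode-filtered V∈ with ∈-filter⁻ bad? {xs = combs n k} V∈
  ... | V∈′ , inj₁ bad = encode {n} {k} true  V∈′ bad
  ... | V∈′ , inj₂ bad = encode {n} {k} false V∈′ bad

-- Sets that are not bad are good

Avoids : ℕ → ℕ → ℕ → ℕ → Set
Avoids y u Z W = y ≢ 0 × y ≢ u × y ≢ Z × y ≢ W

difference-coincidence : ∀ {a b c d u} → 0 < u → a ≢ 0 → a ≤ b → c ≤ d →
                         b ∸ a ≡ (d ∸ c) + u → b ∸ a ≢ u →
                         b + c ≡ a + d + u × (Avoids b u a d ⊎ Avoids c u a d)
difference-coincidence {a} {b} {c} {d} {u} u>0 a≢0 a≤b c≤d coincide b∸a≢u = relation , avoiding
  where
  t : ℕ
  t = d ∸ c
  b≡ : b ≡ a + (t + u)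
  b≡ = trans (sym (m+[n∸m]≡n a≤b)) (cong (a +_) coincide)
  d≡ : d ≡ c + t
  d≡ = sym (m+[n∸m]≡n c≤d)
  relation : b + c ≡ a + d + u
  relation = begin
    b + c              ≡⟨ cong (_+ c) b≡ ⟩
    a + (t + u) + c    ≡⟨ regroup a c t u ⟩
    a + (c + t) + u    ≡˘⟨ cong (λ x → a + x + u) d≡ ⟩
    a + d + u          ∎
    where
    open ≡-Reasoning
    regroup : ∀ a c t u → a + (t + u) + c ≡ a + (c + t) + u
    regroup = solve-∀
  a>0 : 0 < a
  a>0 = n≢0⇒n>0 a≢0
  a<b : a < b
  a<b = subst (a <_) (sym b≡) (m<m+n a (<-≤-trans u>0 (m≤n+m u t)))
  u<b : u < b
  u<b = subst (u <_) (sym b≡) (<-≤-trans (m<n+m u a>0) (+-monoʳ-≤ a (m≤n+m u t)))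
  -- When d = b the term b is not fresh; then c = a + u, and c ≢ d because b ∸ a ≢ u.
  avoiding : Avoids b u a d ⊎ Avoids c u a d
  avoiding with d ≟ b
  ... | no d≢b = inj₁ ((λ b≡0 → <⇒≢ (<-trans a>0 a<b) (sym b≡0)) , (λ b≡u → <⇒≢ u<b (sym b≡u)) ,
                       (λ b≡a → <⇒≢ a<b (sym b≡a)) , (λ b≡d → d≢b (sym b≡d)))
  ... | yes d≡b = inj₂ ((λ c≡0 → <⇒≢ (<-trans a>0 a<c) (sym c≡0)) , (λ c≡u → <⇒≢ u<c (sym c≡u)) ,
                        (λ c≡a → <⇒≢ a<c (sym c≡a)) , c≢d)
    where
    c≡ : c ≡ a + u
    c≡ = +-cancelʳ-≡ t c (a + u) (trans (sym d≡) (trans d≡b (trans b≡ (regroup a t u))))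
      where
      regroup : ∀ a t u → a + (t + u) ≡ a + u + t
      regroup = solve-∀
    a<c : a < c
    a<c = subst (a <_) (sym c≡) (m<m+n a u>0)
    u<c : u < c
    u<c = subst (u <_) (sym c≡) (m<n+m u a>0)
    c≢d : c ≢ d
    c≢d c≡d = b∸a≢u (trans coincide (cong (_+ u) t≡0))
      where
      t≡0 : t ≡ 0
      t≡0 = +-cancelˡ-≡ c t 0 (trans (sym d≡) (trans (sym c≡d) (sym (+-identityʳ c))))

NontrivialRelation : List ℕ → Set
NontrivialRelation V = ∃[ y ] ∃[ Y ] ∃[ Z ] ∃[ W ]
  (y ∈ U V × Y ∈ U V × Z ∈ U V × W ∈ U V × Avoids y (u01 V) Z W × y + Y ≡ Z + W + u01 V)

good-if-no-relation : ∀ V → 0 ∈ U V → u01 V ∈ U V → 0 < u01 V → (∀ x → x ∈ U V → x ≢ 0 → u01 V ≤ x) →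
                      ¬ NontrivialRelation V → Good V
good-if-no-relation V 0∈ u∈ u>0 u-minimal no-relation x = mk⇔ into from
  where
  u : ℕ
  u = u01 V
  into : InU1 V x → InW V x × InW1 V x
  into (x∈ , x≢0) = (0 , x , 0∈ , x∈ , z≤n , refl) ,
    (x ∸ u , (u , x , u∈ , x∈ , u-minimal x x∈ x≢0 , refl) , sym (m∸n+n≡m (u-minimal x x∈ x≢0)))
  from : InW V x × InW1 V x → InU1 V x
  from ((a , b , a∈ , b∈ , a≤b , x≡) , (w , (c , d , c∈ , d∈ , c≤d , w≡) , x≡′)) = x∈ , x≢0
    where
    x≢0 : x ≢ 0
    x≢0 x≡0 = <⇒≢ (<-≤-trans u>0 (m≤n+m u w)) (sym (trans (sym x≡′) x≡0))
    x∈ : x ∈ U V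
    x∈ with a ≟ 0 | b ∸ a ≟ u
    ... | yes refl | _       = subst (_∈ U V) (sym x≡) b∈
    ... | no _     | yes b∸a≡u = subst (_∈ U V) (sym (trans x≡ b∸a≡u)) u∈
    ... | no a≢0   | no b∸a≢u
      with difference-coincidence u>0 a≢0 a≤b c≤d (trans (sym x≡) (trans x≡′ (cong (_+ u) w≡))) b∸a≢u
    ...   | relation , inj₁ b-avoids = ⊥-elim (no-relation (b , c , a , d , b∈ , c∈ , a∈ , d∈ , b-avoids , relation))
    ...   | relation , inj₂ c-avoids =
      ⊥-elim (no-relation (c , b , a , d , c∈ , b∈ , a∈ , d∈ , c-avoids , trans (+-comm c b) relation))

first≤ : ∀ {x r v} → Sorted (x ∷ r) → v ∈ x ∷ r → x ≤ v
first≤ _          (here refl) = ≤-refl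
first≤ (x<r ∷ _)  (there v∈)  = <⇒≤ (All.lookup x<r v∈)

second≤ : ∀ {x y r v} → Sorted (x ∷ y ∷ r) → v ∈ x ∷ y ∷ r → v ≢ x → y ≤ v
second≤ _       (here v≡x) v≢x = ⊥-elim (v≢x v≡x)
second≤ (_ ∷ s) (there v∈) _   = first≤ s v∈

≤lastL : ∀ {l v} → Sorted l → v ∈ l → v ≤ lastL l
≤lastL {x ∷ []}    _         (here refl) = ≤-refl
≤lastL {x ∷ y ∷ r} (x<r ∷ s) (here refl) = <⇒≤ (<-≤-trans (All.head x<r) (≤lastL s (here refl)))
≤lastL {x ∷ y ∷ r} (_ ∷ s)   (there v∈)  = ≤lastL s v∈

lastL∈ : ∀ x r → lastL (x ∷ r) ∈ x ∷ r
lastL∈ x []      = here refl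
lastL∈ x (y ∷ r) = there (lastL∈ y r)

penult∈ : ∀ x y r → penult (x ∷ y ∷ r) ∈ x ∷ y ∷ r
penult∈ x y []      = here refl
penult∈ x y (z ∷ r) = there (penult∈ y z r)

penult<lastL : ∀ {x y r} → Sorted (x ∷ y ∷ r) → penult (x ∷ y ∷ r) < lastL (x ∷ y ∷ r)
penult<lastL {r = []}    (x<r ∷ _) = All.head x<r
penult<lastL {r = _ ∷ _} (_ ∷ s)   = penult<lastL s

≤penult : ∀ {x y r v} → Sorted (x ∷ y ∷ r) → v ∈ x ∷ y ∷ r → v ≢ lastL (x ∷ y ∷ r) → v ≤ penult (x ∷ y ∷ r)
≤penult {r = []}    _         (here refl)         _   = ≤-refl
≤penult {r = []}    _         (there (here v≡y))  v≢y = ⊥-elim (v≢y v≡y)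
≤penult {y = y} {z ∷ r} (x<r ∷ s) (here refl) _ = <⇒≤ (<-≤-trans (All.head x<r) (≤penult s (here refl) y≢L))
  where
  y≢L : y ≢ lastL (y ∷ z ∷ r)
  y≢L = <⇒≢ (<-≤-trans (All.head (AllPairs.head s)) (≤lastL (AllPairs.tail s) (here refl)))
≤penult {r = _ ∷ _} (_ ∷ s)   (there v∈)          v≢L = ≤penult s v∈ v≢L

≢-preimage : ∀ (f : ℕ → ℕ) {a b A B} → a ≡ f A → b ≡ f B → a ≢ b → A ≢ B
≢-preimage f a≡ b≡ a≢b A≡B = a≢b (trans a≡ (trans (cong f A≡B) (sym b≡)))

shift-relation : ∀ {y Y Z W y′ Y′ Z′ W′ u v₀ v₁} →
                 y ≡ y′ + v₀ → Y ≡ Y′ + v₀ → Z ≡ Z′ + v₀ → W ≡ W′ + v₀ → v₁ ≡ u + v₀ →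
                 y′ + Y′ ≡ Z′ + W′ + u → y + Y + v₀ ≡ Z + W + v₁
shift-relation {y′ = y′} {Y′} {Z′} {W′} {u} {v₀} refl refl refl refl refl relation = begin
  y′ + v₀ + (Y′ + v₀) + v₀          ≡⟨ spread y′ Y′ v₀ ⟩
  y′ + Y′ + (v₀ + v₀ + v₀)          ≡⟨ cong (_+ (v₀ + v₀ + v₀)) relation ⟩
  Z′ + W′ + u + (v₀ + v₀ + v₀)      ≡⟨ gather Z′ W′ u v₀ ⟩
  Z′ + v₀ + (W′ + v₀) + (u + v₀)    ∎
  where
  open ≡-Reasoning
  spread : ∀ y Y v → y + v + (Y + v) + v ≡ y + Y + (v + v + v)
  spread = solve-∀
  gather : ∀ Z W u v → Z + W + u + (v + v + v) ≡ Z + v + (W + v) + (u + v)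
  gather = solve-∀

reflect-relation : ∀ {y Y Z W y′ Y′ Z′ W′ u P L} →
                   y + y′ ≡ L → Y + Y′ ≡ L → Z + Z′ ≡ L → W + W′ ≡ L → P + u ≡ L →
                   y′ + Y′ ≡ Z′ + W′ + u → y + Y + L ≡ Z + W + P
reflect-relation {y} {Y} {Z} {W} {y′} {Y′} {Z′} {W′} {u} {P} {L} y≡ Y≡ Z≡ W≡ P≡ relation =
  +-cancelʳ-≡ (y′ + Y′) _ _ (begin
    y + Y + L + (y′ + Y′)             ≡⟨ pair-up y Y y′ Y′ L ⟩
    (y + y′) + (Y + Y′) + L           ≡⟨ cong₂ (λ p q → p + q + L) y≡ Y≡ ⟩
    L + L + L                         ≡˘⟨ cong₂ (λ p q → p + q + L) Z≡ W≡ ⟩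
    (Z + Z′) + (W + W′) + L           ≡˘⟨ cong ((Z + Z′) + (W + W′) +_) P≡ ⟩
    (Z + Z′) + (W + W′) + (P + u)     ≡˘⟨ pair-up′ Z W Z′ W′ P u ⟩
    Z + W + P + (Z′ + W′ + u)         ≡˘⟨ cong (Z + W + P +_) relation ⟩
    Z + W + P + (y′ + Y′)             ∎)
  where
  open ≡-Reasoning
  pair-up : ∀ y Y y′ Y′ L → y + Y + L + (y′ + Y′) ≡ (y + y′) + (Y + Y′) + L
  pair-up = solve-∀
  pair-up′ : ∀ Z W Z′ W′ P u → Z + W + P + (Z′ + W′ + u) ≡ (Z + Z′) + (W + W′) + (P + u)
  pair-up′ = solve-∀

module LeftCase {v₀ v₁ r} (sorted : Sorted (v₀ ∷ v₁ ∷ r)) (left : leftCase (v₀ ∷ v₁ ∷ r) ≡ true) where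

  V : List ℕ
  V = v₀ ∷ v₁ ∷ r

  U≡ : U V ≡ map (_∸ v₀) V
  U≡ = cong (λ b → if b then map (_∸ v₀) V else map (lastL V ∸_) V) left

  u≡ : u01 V ≡ v₁ ∸ v₀
  u≡ = cong (λ b → if b then v₁ ∸ v₀ else lastL V ∸ penult V) left

  v₀<v₁ : v₀ < v₁
  v₀<v₁ = All.head (AllPairs.head sorted)

  preimage : ∀ {a} → a ∈ U V → ∃[ A ] (A ∈ V × a ≡ A ∸ v₀)
  preimage a∈ = ∈-map⁻ (_∸ v₀) (subst (_ ∈_) U≡ a∈)

  unshift : ∀ {a A} → a ≡ A ∸ v₀ → A ∈ V → A ≡ a + v₀
  unshift a≡ A∈ = trans (sym (m∸n+n≡m (first≤ sorted A∈))) (cong (_+ v₀) (sym a≡))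

  0∈U : 0 ∈ U V
  0∈U = subst (0 ∈_) (sym U≡) (subst (_∈ map (_∸ v₀) V) (n∸n≡0 v₀) (∈-map⁺ (_∸ v₀) (here refl)))

  u∈U : u01 V ∈ U V
  u∈U = subst₂ _∈_ (sym u≡) (sym U≡) (∈-map⁺ (_∸ v₀) (there (here refl)))

  u>0 : 0 < u01 V
  u>0 = subst (0 <_) (sym u≡) (m<n⇒0<n∸m v₀<v₁)

  u-minimal : ∀ x → x ∈ U V → x ≢ 0 → u01 V ≤ x
  u-minimal x x∈ x≢0 with preimage x∈
  ... | A , A∈ , x≡ = subst₂ _≤_ (sym u≡) (sym x≡)
    (∸-monoˡ-≤ v₀ (second≤ sorted A∈ (≢-preimage (_∸ v₀) x≡ (sym (n∸n≡0 v₀)) x≢0)))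

  relation⇒bad : NontrivialRelation V → Bad V
  relation⇒bad (y′ , Y′ , Z′ , W′ , y′∈ , Y′∈ , Z′∈ , W′∈ , (y′≢0 , y′≢u , y′≢Z′ , y′≢W′) , relation)
    with preimage y′∈ | preimage Y′∈ | preimage Z′∈ | preimage W′∈
  ... | y , y∈ , y′≡ | Y , Y∈ , Y′≡ | Z , Z∈ , Z′≡ | W , W∈ , W′≡ = inj₁
    (y , Y , Z , W , y∈ , Y∈ , Z∈ , W∈ ,
     ≢-preimage (_∸ v₀) y′≡ (sym (n∸n≡0 v₀)) y′≢0 , ≢-preimage (_∸ v₀) y′≡ u≡ y′≢u ,
     ≢-preimage (_∸ v₀) y′≡ Z′≡ y′≢Z′ , ≢-preimage (_∸ v₀) y′≡ W′≡ y′≢W′ ,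
     shift-relation (unshift y′≡ y∈) (unshift Y′≡ Y∈) (unshift Z′≡ Z∈) (unshift W′≡ W∈)
       (trans (sym (m∸n+n≡m (<⇒≤ v₀<v₁))) (cong (_+ v₀) (sym u≡))) relation)

  good : ¬ Bad V → Good V
  good ¬bad = good-if-no-relation V 0∈U u∈U u>0 u-minimal (¬bad ∘ relation⇒bad)

module RightCase {v₀ v₁ r} (sorted : Sorted (v₀ ∷ v₁ ∷ r)) (right : leftCase (v₀ ∷ v₁ ∷ r) ≡ false) where

  V : List ℕ
  V = v₀ ∷ v₁ ∷ r
  L P : ℕ
  L = lastL V
  P = penult V

  U≡ : U V ≡ map (L ∸_) V
  U≡ = cong (λ b → if b then map (_∸ v₀) V else map (L ∸_) V) right

  u≡ : u01 V ≡ L ∸ P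
  u≡ = cong (λ b → if b then v₁ ∸ v₀ else L ∸ P) right

  P<L : P < L
  P<L = penult<lastL sorted

  preimage : ∀ {a} → a ∈ U V → ∃[ A ] (A ∈ V × a ≡ L ∸ A)
  preimage a∈ = ∈-map⁻ (L ∸_) (subst (_ ∈_) U≡ a∈)

  unreflect : ∀ {a A} → a ≡ L ∸ A → A ∈ V → A + a ≡ L
  unreflect a≡ A∈ = trans (cong (_ +_) a≡) (m+[n∸m]≡n (≤lastL sorted A∈))

  0∈U : 0 ∈ U V
  0∈U = subst (0 ∈_) (sym U≡) (subst (_∈ map (L ∸_) V) (n∸n≡0 L) (∈-map⁺ (L ∸_) (lastL∈ v₀ (v₁ ∷ r))))

  u∈U : u01 V ∈ U V
  u∈U = subst₂ _∈_ (sym u≡) (sym U≡) (∈-map⁺ (L ∸_) (penult∈ v₀ v₁ r))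

  u>0 : 0 < u01 V
  u>0 = subst (0 <_) (sym u≡) (m<n⇒0<n∸m P<L)

  u-minimal : ∀ x → x ∈ U V → x ≢ 0 → u01 V ≤ x
  u-minimal x x∈ x≢0 with preimage x∈
  ... | A , A∈ , x≡ = subst₂ _≤_ (sym u≡) (sym x≡)
    (∸-monoʳ-≤ L (≤penult sorted A∈ (≢-preimage (L ∸_) x≡ (sym (n∸n≡0 L)) x≢0)))

  relation⇒bad : NontrivialRelation V → Bad V
  relation⇒bad (y′ , Y′ , Z′ , W′ , y′∈ , Y′∈ , Z′∈ , W′∈ , (y′≢0 , y′≢u , y′≢Z′ , y′≢W′) , relation)
    with preimage y′∈ | preimage Y′∈ | preimage Z′∈ | preimage W′∈
  ... | y , y∈ , y′≡ | Y , Y∈ , Y′≡ | Z , Z∈ , Z′≡ | W , W∈ , W′≡ = inj₂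
    (y , Y , Z , W , y∈ , Y∈ , Z∈ , W∈ ,
     ≢-preimage (L ∸_) y′≡ (sym (n∸n≡0 L)) y′≢0 , ≢-preimage (L ∸_) y′≡ u≡ y′≢u ,
     ≢-preimage (L ∸_) y′≡ Z′≡ y′≢Z′ , ≢-preimage (L ∸_) y′≡ W′≡ y′≢W′ ,
     reflect-relation {y} {Y} {Z} {W} {y′} {Y′} {Z′} {W′} {u01 V} {P} {L}
       (unreflect y′≡ y∈) (unreflect Y′≡ Y∈) (unreflect Z′≡ Z∈) (unreflect W′≡ W∈)
       (trans (cong (P +_) u≡) (m+[n∸m]≡n (<⇒≤ P<L))) relation)

  good : ¬ Bad V → Good V
  good ¬bad = good-if-no-relation V 0∈U u∈U u>0 u-minimal (¬bad ∘ relation⇒bad)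

good-if-not-bad : ∀ {V} → Sorted V → 2 ≤ length V → ¬ Bad V → Good V
good-if-not-bad {V@(_ ∷ _ ∷ _)} sorted _ = by-side (leftCase V) refl
  where
  by-side : ∀ b → leftCase V ≡ b → ¬ Bad V → Good V
  by-side true  left  = LeftCase.good sorted left
  by-side false right = RightCase.good sorted right
good-if-not-bad {_ ∷ []} _ (s≤s ())
good-if-not-bad {[]}     _ ()

-- Density of good sets

length-filter-∁+length-filter : ∀ {P : List ℕ → Set} (P? : ∀ V → Dec (P V)) l →
                                length (filter (¬? ∘ P?) l) + length (filter P? l) ≡ length l
length-filter-∁+length-filter P? []      = refl
length-filter-∁+length-filter P? (x ∷ l) with P? x
... | yes _ = trans (+-suc _ _) (cong suc (length-filter-∁+length-filter P? l))
... | no  _ = cong suc (length-filter-∁+length-filter P? l)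

-- With K = j + 1: K C(n,K) = (n - j) C(n,j) > 2b K⁴ C(n,j) ≥ K b #bad.
bad-sparse : ∀ b n j → (2 * b + 1) * suc j ^ 4 < n → b * length (filter bad? (combs n (suc j))) < binom n (suc j)
bad-sparse b n j small = *-cancelˡ-< K (b * X) T (+-cancelʳ-< (j * c) (K * (b * X)) (K * T) (begin-strict
    K * (b * X) + j * c                      ≤⟨ +-monoˡ-≤ (j * c) (*-monoʳ-≤ K (*-monoʳ-≤ b (bad-count n K))) ⟩
    K * (b * (c * (2 * (K * (K * K))))) + j * c ≡⟨ regroup K b c j ⟩
    2 * b * K ^ 4 * c + j * c                ≤⟨ +-monoʳ-≤ (2 * b * K ^ 4 * c) (*-monoˡ-≤ c j≤K⁴) ⟩
    2 * b * K ^ 4 * c + K ^ 4 * c            ≡⟨ factor (2 * b) (K ^ 4) c ⟩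
    (2 * b + 1) * K ^ 4 * c                  <⟨ *-monoˡ-< c {{>-nonZero c>0}} small ⟩
    n * c                                    ≡˘⟨ binom-absorption n j ⟩
    K * T + j * c                            ∎))
  where
  open ≤-Reasoning
  K X T c : ℕ
  K = suc j
  X = length (filter bad? (combs n K))
  T = binom n K
  c = binom n j
  j≤K⁴ : j ≤ K ^ 4
  j≤K⁴ = ≤-trans (n≤1+n j) (m≤m*n K (K ^ 3))
  K≤n : K ≤ n
  K≤n = <⇒≤ (≤-<-trans (≤-trans (m≤m*n K (K ^ 3)) (m≤n*m (K ^ 4) (2 * b + 1) {{>-nonZero (m≤n+m 1 (2 * b))}})) small)
  c>0 : 0 < c
  c>0 = binom-pos (≤-trans (n≤1+n j) K≤n)
  regroup : ∀ K b c j → K * (b * (c * (2 * (K * (K * K))))) + j * c ≡ 2 * b * (K * (K * (K * (K * 1)))) * c + j * c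
  regroup = solve-∀
  factor : ∀ x y c → x * y * c + y * c ≡ (x + 1) * y * c
  factor = solve-∀

^-distribʳ-* : ∀ m n o → (m * n) ^ o ≡ m ^ o * n ^ o
^-distribʳ-* m n zero    = refl
^-distribʳ-* m n (suc o) = trans (cong (m * n *_) (^-distribʳ-* m n o)) (interchange m n (m ^ o) (n ^ o))
  where
  interchange : ∀ m n x y → m * n * (x * y) ≡ m * x * (n * y)
  interchange = solve-∀

-- If n ≤ M K⁴, the growth bound would give n ≤ n^{4p} ≤ C M^q.
eventually-small : ∀ {p q C M n K} → 0 < p → 0 < K → K ^ (4 * q) * n ^ (4 * p) ≤ C * n ^ q →
                   C * M ^ q < n → M * K ^ 4 < n
eventually-small {suc p} {q} {C} {M} {n} {K@(suc _)} _ _ growth large = ≰⇒> λ n≤MK⁴ →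
  <⇒≱ large (begin
    n                 ≡˘⟨ ^-identityʳ n ⟩
    n ^ 1             ≤⟨ ^-monoʳ-≤ n {{n≢0}} {1} {4 * suc p} (s≤s z≤n) ⟩
    n ^ (4 * suc p)   ≤⟨ *-cancelˡ-≤ (K ^ (4 * q)) {{m^n≢0 K (4 * q)}} (scaled n≤MK⁴) ⟩
    C * M ^ q         ∎)
  where
  open ≤-Reasoning
  n≢0 : NonZero n
  n≢0 = >-nonZero (≤-<-trans z≤n large)
  bound : n ≤ M * K ^ 4 → n ^ q ≤ K ^ (4 * q) * M ^ q
  bound n≤MK⁴ = begin
    n ^ q                   ≤⟨ ^-monoˡ-≤ q n≤MK⁴ ⟩
    (M * K ^ 4) ^ q         ≡⟨ ^-distribʳ-* M (K ^ 4) q ⟩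
    M ^ q * (K ^ 4) ^ q     ≡⟨ cong (M ^ q *_) (^-*-assoc K 4 q) ⟩
    M ^ q * K ^ (4 * q)     ≡⟨ *-comm (M ^ q) (K ^ (4 * q)) ⟩
    K ^ (4 * q) * M ^ q     ∎
  scaled : n ≤ M * K ^ 4 → K ^ (4 * q) * n ^ (4 * suc p) ≤ K ^ (4 * q) * (C * M ^ q)
  scaled n≤MK⁴ = begin
    K ^ (4 * q) * n ^ (4 * suc p)  ≤⟨ growth ⟩
    C * n ^ q                      ≤⟨ *-monoʳ-≤ C (bound n≤MK⁴) ⟩
    C * (K ^ (4 * q) * M ^ q)      ≡⟨ x∙yz≈y∙xz C (K ^ (4 * q)) (M ^ q) ⟩
    K ^ (4 * q) * (C * M ^ q)      ∎

dense-good-subsets : ∀ {a b n K} → 0 < a → 2 ≤ K → (2 * b + 1) * K ^ 4 < n →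
                     ∃[ S ] (S ⊆ combs n K × All Good S × b * binom n K < b * length S + a * binom n K)
dense-good-subsets {a} {b} {n} {K@(suc j)} a>0 2≤K small = S , filter-⊆ (¬? ∘ bad?) (combs n K) , All.tabulate good , dense
  where
  S B : List (List ℕ)
  S = filter (¬? ∘ bad?) (combs n K)
  B = filter bad? (combs n K)
  good : ∀ {V} → V ∈ S → Good V
  good V∈ with ∈-filter⁻ (¬? ∘ bad?) {xs = combs n K} V∈
  ... | V∈′ , ¬bad =
    let sorted , _ , length≡ = ∈-combs⁻ n K V∈′ in good-if-not-bad sorted (subst (2 ≤_) (sym length≡) 2≤K) ¬bad
  dense : b * binom n K < b * length S + a * binom n K
  dense = begin-strict
    b * binom n K                 ≡˘⟨ cong (b *_) (length-filter-∁+length-filter bad? (combs n K)) ⟩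
    b * (length S + length B)     ≡⟨ *-distribˡ-+ b (length S) (length B) ⟩
    b * length S + b * length B   <⟨ +-monoʳ-< (b * length S) (bad-sparse b n j small) ⟩
    b * length S + binom n K      ≤⟨ +-monoʳ-≤ (b * length S) (m≤n*m (binom n K) a {{>-nonZero a>0}}) ⟩
    b * length S + a * binom n K  ∎
    where open ≤-Reasoning

corollary1 : (p q : ℕ) → 0 < p → 0 < q
    → (k : ℕ → ℕ) → (∀ n → 2 ≤ k n)
    → (∃[ C ] ∃[ N ] ((n : ℕ) → N ≤ n → k n ^ (4 * q) * n ^ (4 * p) ≤ C * n ^ q))
    → (a b : ℕ) → 0 < a → 0 < b
    → ∃[ N₀ ] ((n : ℕ) → N₀ < n →
         ∃[ S ] (S ⊆ combs n (k n) × All Good S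
                 × b * length (combs n (k n)) < b * length S + a * length (combs n (k n))))
corollary1 p q p>0 _ k 2≤k (C , N , growth) a b a>0 _ = N + C * M ^ q , λ n N₀<n →
  dense-good-subsets {b = b} a>0 (2≤k n)
    (eventually-small {q = q} {C} {M} p>0 (<-≤-trans (s≤s z≤n) (2≤k n))
      (growth n (≤-trans (m≤m+n N (C * M ^ q)) (<⇒≤ N₀<n)))
      (≤-<-trans (m≤n+m (C * M ^ q) N) N₀<n))
  where
  M : ℕ
  M = 2 * b + 1
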